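{- If $r\geq 4$ and $n\geq r+1$, then $\sigma(K_{r+1}-Z_4,n)\geq\sigma(K_{r+1}-K_4,n)$ and $$\sigma(K_{r+1}-K_4,n)\geq\begin{cases}(r-1)(2n-r)-3(n-r)+1, & \text{if } n-r \text{ is odd},\\ (r-1)(2n-r)-3(n-r)+2, & \text{if } n-r \text{ is even}.\end{cases}$$
   Context: A sequence $\pi=(d_1,\dots,d_n)$ of nonnegative integers with $d_1\geq\cdots\geq d_n$ is graphic if it is the degree sequence of a simple graph on $n$ vertices (a realization); $\sigma(\pi)=d_1+\cdots+d_n$. $\pi$ is potentially $H$-graphic if some realization contains $H$ as a subgraph. For a subgraph $H$ of $K_m$, $K_m-H$ is $K_m$ with the edges of $H$ deleted. $\sigma(H,n)$ is the smallest even integer $l$ such that every $n$-term graphic sequence $\pi$ with $\sigma(\pi)\geq l$ is potentially $H$-graphic. $P_2$ is the path on $3$ vertices and $Z_4=K_4-P_2$ (a triangle with a pendant edge). -}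

module Defs where

open import Data.Nat using (ℕ; zero; suc; _+_; _*_; _∸_; _≤_; _<_; _≥_)
open import Data.Nat.Base using (_<ᵇ_; _≡ᵇ_)
open import Data.Nat.Divisibility using (_∣_)
open import Data.Bool using (Bool; true; false; if_then_else_; _∧_; _∨_; not)
open import Data.Fin using (Fin; toℕ)
import Data.Fin as F
open import Data.List using (List; map; allFin)
open import Data.Nat.ListAction using (sum)
open import Data.Product using (Σ; ∃; _×_; _,_)
open import Relation.Binary.PropositionalEquality using (_≡_; refl; cong; cong₂)
open import Data.Bool.Properties using (∧-comm; ∨-comm)
open import Function.Definitions using (Injective)

record Graph (n : ℕ) : Set where
  field
    adj    : Fin n → Fin n → Bool
    sym    : ∀ i j → adj i j ≡ adj j i
    irrefl : ∀ i → adj i i ≡ false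
open Graph public

deg : ∀ {n} → Graph n → Fin n → ℕ
deg {n} G i = sum (map (λ j → if adj G i j then 1 else 0) (allFin n))

Seq : ℕ → Set
Seq n = Fin n → ℕ

NonIncreasing : ∀ {n} → Seq n → Set
NonIncreasing {n} π = ∀ (i j : Fin n) → toℕ i ≤ toℕ j → π j ≤ π i

σseq : ∀ {n} → Seq n → ℕ
σseq {n} π = sum (map π (allFin n))

Realizes : ∀ {n} → Graph n → Seq n → Set
Realizes {n} G π = ∀ (i : Fin n) → deg G i ≡ π i

Graphic : ∀ {n} → Seq n → Set
Graphic {n} π = NonIncreasing π × Σ (Graph n) (λ G → Realizes G π)

SubgraphOf : ∀ {m n} → Graph m → Graph n → Set
SubgraphOf {m} {n} H G =
  Σ (Fin m → Fin n) (λ f → Injective _≡_ _≡_ f ×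
     (∀ i j → adj H i j ≡ true → adj G (f i) (f j) ≡ true))

PotentiallyGraphic : ∀ {m n} → Graph m → Seq n → Set
PotentiallyGraphic {m} {n} H π =
  Σ (Graph n) (λ G → Realizes G π × SubgraphOf H G)

Admissible : ∀ {m} → Graph m → ℕ → ℕ → Set
Admissible H n l =
  2 ∣ l × (∀ (π : Seq n) → Graphic π → σseq π ≥ l → PotentiallyGraphic H π)

IsSigma : ∀ {m} → Graph m → ℕ → ℕ → Set
IsSigma H n s = Admissible H n s × (∀ l → Admissible H n l → s ≤ l)

-- K_{r+1} - K_4 and K_{r+1} - Z_4 on vertex set Fin (r+1);
-- the removed K_4 / Z_4 lives on vertices 0,1,2,3.

private
  neq : ℕ → ℕ → Bool
  neq a b = not (a ≡ᵇ b)

  small : ℕ → Bool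
  small a = a <ᵇ 4

  -- edges of P_2 = path 0 - 1 - 2 (so Z_4 = K_4 - P_2 has edges 02,03,13,23:
  -- triangle 0,2,3 with pendant edge 3-1)
  q : ℕ → ℕ → Bool
  q a b = ((a ≡ᵇ 0) ∧ (b ≡ᵇ 1)) ∨ ((a ≡ᵇ 1) ∧ (b ≡ᵇ 2))

  p2 : ℕ → ℕ → Bool
  p2 a b = q a b ∨ q b a

adjKminusK4 : ℕ → ℕ → Bool
adjKminusK4 a b = neq a b ∧ not (small a ∧ small b)

adjKminusZ4 : ℕ → ℕ → Bool
adjKminusZ4 a b = neq a b ∧ (not (small a ∧ small b) ∨ p2 a b)

private
  ≡ᵇ-sym : ∀ a b → (a ≡ᵇ b) ≡ (b ≡ᵇ a)
  ≡ᵇ-sym zero zero = refl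
  ≡ᵇ-sym zero (suc b) = refl
  ≡ᵇ-sym (suc a) zero = refl
  ≡ᵇ-sym (suc a) (suc b) = ≡ᵇ-sym a b

  ≡ᵇ-refl : ∀ a → (a ≡ᵇ a) ≡ true
  ≡ᵇ-refl zero = refl
  ≡ᵇ-refl (suc a) = ≡ᵇ-refl a

  neq-sym : ∀ a b → neq a b ≡ neq b a
  neq-sym a b = cong not (≡ᵇ-sym a b)

  neq-refl : ∀ a → neq a a ≡ false
  neq-refl a = cong not (≡ᵇ-refl a)

  small2-sym : ∀ a b → not (small a ∧ small b) ≡ not (small b ∧ small a)
  small2-sym a b = cong not (∧-comm (small a) (small b))

K-K4 : (m : ℕ) → Graph m
adj (K-K4 m) i j = adjKminusK4 (toℕ i) (toℕ j)
sym (K-K4 m) i j = cong₂ _∧_ (neq-sym (toℕ i) (toℕ j)) (small2-sym (toℕ i) (toℕ j))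
irrefl (K-K4 m) i = cong (_∧ not (small (toℕ i) ∧ small (toℕ i))) (neq-refl (toℕ i))

K-Z4 : (m : ℕ) → Graph m
adj (K-Z4 m) i j = adjKminusZ4 (toℕ i) (toℕ j)
sym (K-Z4 m) i j = cong₂ _∧_ (neq-sym (toℕ i) (toℕ j))
  (cong₂ _∨_ (small2-sym (toℕ i) (toℕ j)) (∨-comm (q (toℕ i) (toℕ j)) (q (toℕ j) (toℕ i))))
irrefl (K-Z4 m) i = cong (_∧ (not (small (toℕ i) ∧ small (toℕ i)) ∨ p2 (toℕ i) (toℕ i))) (neq-refl (toℕ i))

{-# OPTIONS --safe #-}
-- Since K_{r+1} - K_4 is a subgraph of K_{r+1} - Z_4, every sequence that is potentially
-- (K_{r+1} - Z_4)-graphic is potentially (K_{r+1} - K_4)-graphic, which gives the first inequality.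
-- For the second, write r = 4 + B and n = r + d, and let π be the degree sequence of the join of
-- K_B with the cycle on d + 4 vertices carrying 2 + ⌊d/2⌋ chords: B terms equal n - 1 and the
-- other d + 4 terms are B + 2 or B + 3.  A realization containing K_{r+1} - K_4 needs r - 3 = B + 1
-- vertices of degree at least r, so π is not potentially (K_{r+1} - K_4)-graphic and
-- σ(K_{r+1} - K_4, n) > σ(π).  Both numbers are even (σ(π) by the handshake lemma), hence
-- σ(K_{r+1} - K_4, n) ≥ σ(π) + 2, and σ(π) + 2 is exactly the stated bound.
module Submission where

open import Defs hiding (sym)
open import Data.Bool using (Bool; true; if_then_else_; not; _∧_; _∨_)
open import Data.Empty using (⊥-elim)
open import Data.Fin using (Fin; toℕ; fromℕ<; punchIn; punchOut; _↑ʳ_) renaming (zero to fzero; suc to fsuc)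
open import Data.Fin.Properties using (any?; punchOut-injective; punchIn-injective; punchIn-punchOut; punchInᵢ≢i; injective⇒≤; toℕ-injective; toℕ-fromℕ<; ↑ʳ-injective; toℕ<n) renaming (_≟_ to _≟ᶠ_)
open import Data.List using ([]; _∷_; map; applyUpTo; allFin)
open import Data.List.Properties using (map-tabulate; map-cong)
open import Data.Nat
open import Data.Nat.DivMod using (_/_; _%_; m≡m%n+[m/n]*n; m/n≤m)
open import Data.Nat.Divisibility using (_∣_; divides; _∣0; ∣m∣n⇒∣m+n; m∣m*n)
open import Data.Nat.ListAction using (sum)
open import Data.Nat.Properties
open import Data.Nat.Tactic.RingSolver using (solve-∀)
open import Data.Product using (_×_; _,_; proj₁)
open import Data.Sum using (_⊎_; inj₁; inj₂; [_,_])
open import Function using (_∘_; _⇔_; mk⇔)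
open import Function.Definitions using (Injective)
open import Relation.Binary.PropositionalEquality using (_≡_; _≢_; refl; sym; trans; cong; cong₂; subst; subst₂; module ≡-Reasoning)
open import Relation.Nullary using (Dec; yes; no; ¬_; does)
open import Relation.Nullary.Decidable using (map′; _×-dec_; _⊎-dec_; ¬?; does-⇔; dec-false; toSum)
open import Relation.Unary using (Pred; Decidable)
open import Algebra.Properties.CommutativeSemigroup +-commutativeSemigroup using (interchange)

-- Counting

ind : Bool → ℕ
ind b = if b then 1 else 0

𝟙 : ∀ {a} {A : Set a} → Dec A → ℕ
𝟙 a? = ind (does a?)

𝟙-yes : ∀ {a} {A : Set a} (a? : Dec A) → A → 𝟙 a? ≡ 1
𝟙-yes (yes _) _ = refl
𝟙-yes (no ¬a) a = ⊥-elim (¬a a)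

𝟙≤1 : ∀ {a} {A : Set a} (a? : Dec A) → 𝟙 a? ≤ 1
𝟙≤1 (yes _) = ≤-refl
𝟙≤1 (no _)  = z≤n

𝟙-mono : ∀ {a b} {A : Set a} {B : Set b} (a? : Dec A) (b? : Dec B) → (A → B) → 𝟙 a? ≤ 𝟙 b?
𝟙-mono (yes a) b? A⇒B = ≤-reflexive (sym (𝟙-yes b? (A⇒B a)))
𝟙-mono (no _)  b? A⇒B = z≤n

𝟙-⇔ : ∀ {a b} {A : Set a} {B : Set b} → A ⇔ B → (a? : Dec A) (b? : Dec B) → 𝟙 a? ≡ 𝟙 b?
𝟙-⇔ A⇔B a? b? = cong ind (does-⇔ A⇔B a? b?)

𝟙-⊎ : ∀ {a b} {A : Set a} {B : Set b} → (A → ¬ B) → (a? : Dec A) (b? : Dec B) →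
      𝟙 (a? ⊎-dec b?) ≡ 𝟙 a? + 𝟙 b?
𝟙-⊎ A⇒¬B (yes a) (yes b) = ⊥-elim (A⇒¬B a b)
𝟙-⊎ A⇒¬B (yes a) (no _)  = refl
𝟙-⊎ A⇒¬B (no _)  b?      = refl

𝟙-exactly-one : ∀ {a b} {A : Set a} {B : Set b} (a? : Dec A) (b? : Dec B) →
                (A → ¬ B) → A ⊎ B → 𝟙 a? + 𝟙 b? ≡ 1
𝟙-exactly-one a? b? A⇒¬B A⊎B = trans (sym (𝟙-⊎ A⇒¬B a? b?)) (𝟙-yes (a? ⊎-dec b?) A⊎B)

sumUpTo : (ℕ → ℕ) → ℕ → ℕ
sumUpTo f n = sum (applyUpTo f n)

sumUpTo-cong : ∀ {f g} n → (∀ {y} → y < n → f y ≡ g y) → sumUpTo f n ≡ sumUpTo g n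
sumUpTo-cong zero    f≡g = refl
sumUpTo-cong (suc n) f≡g = cong₂ _+_ (f≡g z<s) (sumUpTo-cong n (f≡g ∘ s<s))

sumUpTo-+ : ∀ f g n → sumUpTo (λ y → f y + g y) n ≡ sumUpTo f n + sumUpTo g n
sumUpTo-+ f g zero    = refl
sumUpTo-+ f g (suc n) = begin
  f 0 + g 0 + sumUpTo (λ y → f (suc y) + g (suc y)) n
    ≡⟨ cong (f 0 + g 0 +_) (sumUpTo-+ (f ∘ suc) (g ∘ suc) n) ⟩
  f 0 + g 0 + (sumUpTo (f ∘ suc) n + sumUpTo (g ∘ suc) n)
    ≡⟨ interchange (f 0) (g 0) _ _ ⟩
  f 0 + sumUpTo (f ∘ suc) n + (g 0 + sumUpTo (g ∘ suc) n) ∎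
  where open ≡-Reasoning

sumUpTo-const : ∀ c n → sumUpTo (λ _ → c) n ≡ n * c
sumUpTo-const c zero    = refl
sumUpTo-const c (suc n) = cong (c +_) (sumUpTo-const c n)

sumUpTo-zero : ∀ n → sumUpTo (λ _ → 0) n ≡ 0
sumUpTo-zero n = trans (sumUpTo-const 0 n) (*-zeroʳ n)

sumUpTo-+-range : ∀ f m n → sumUpTo f (m + n) ≡ sumUpTo f m + sumUpTo (f ∘ (m +_)) n
sumUpTo-+-range f zero    n = refl
sumUpTo-+-range f (suc m) n =
  trans (cong (f 0 +_) (sumUpTo-+-range (f ∘ suc) m n)) (sym (+-assoc (f 0) _ _))

count : ∀ {p} {P : Pred ℕ p} → Decidable P → ℕ → ℕ
count P? n = sumUpTo (𝟙 ∘ P?) n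

module _ {p q} {P : Pred ℕ p} {Q : Pred ℕ q} where

  count-cong : (P? : Decidable P) (Q? : Decidable Q) (n : ℕ) →
               (∀ {y} → y < n → P y ⇔ Q y) → count P? n ≡ count Q? n
  count-cong P? Q? n P⇔Q = sumUpTo-cong n (λ y<n → 𝟙-⇔ (P⇔Q y<n) (P? _) (Q? _))

  count-⊎ : (P? : Decidable P) (Q? : Decidable Q) (n : ℕ) → (∀ {y} → P y → ¬ Q y) →
            count (λ y → P? y ⊎-dec Q? y) n ≡ count P? n + count Q? n
  count-⊎ P? Q? n disjoint =
    trans (sumUpTo-cong n (λ _ → 𝟙-⊎ disjoint (P? _) (Q? _))) (sumUpTo-+ _ _ n)

count-all : ∀ {p} {P : Pred ℕ p} (P? : Decidable P) n → (∀ {y} → y < n → P y) → count P? n ≡ n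
count-all P? n all = begin
  count P? n           ≡⟨ sumUpTo-cong n (λ y<n → 𝟙-yes (P? _) (all y<n)) ⟩
  sumUpTo (λ _ → 1) n  ≡⟨ sumUpTo-const 1 n ⟩
  n * 1                ≡⟨ *-identityʳ n ⟩
  n ∎
  where open ≡-Reasoning

count-∁ : ∀ {p} {P : Pred ℕ p} (P? : Decidable P) (n : ℕ) → count P? n + count (¬? ∘ P?) n ≡ n
count-∁ P? n = trans (sym (count-⊎ P? (¬? ∘ P?) n (λ p ¬p → ¬p p)))
                     (count-all (λ y → P? y ⊎-dec ¬? (P? y)) n (λ {y} _ → toSum (P? y)))

count-≡ : ∀ {a n} → a < n → count (_≟ a) n ≡ 1
count-≡ {zero}  {suc n} _ = cong suc (sumUpTo-zero n)
count-≡ {suc a} {suc n} (s≤s a<n) = count-≡ a<n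

count-point : ∀ {p} {A : Set p} (A? : Dec A) {a n} → (A → a < n) →
              count (λ y → A? ×-dec (y ≟ a)) n ≡ 𝟙 A?
count-point (yes x) a<n = count-≡ (a<n x)
count-point (no _)  {n = n} _ = sumUpTo-zero n

count-< : ∀ {c n} → c ≤ n → count (_<? c) n ≡ c
count-< {zero}  {n}     _         = sumUpTo-zero n
count-< {suc c} {suc n} (s≤s c≤n) = cong suc (count-< c≤n)

sum-map-+ : ∀ {a} {A : Set a} (f g : A → ℕ) xs →
            sum (map (λ x → f x + g x) xs) ≡ sum (map f xs) + sum (map g xs)
sum-map-+ f g []       = refl
sum-map-+ f g (x ∷ xs) =
  trans (cong (f x + g x +_) (sum-map-+ f g xs)) (interchange (f x) (g x) _ _)

sum-allFin-suc : ∀ {n} (f : Fin (suc n) → ℕ) →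
                 sum (map f (allFin (suc n))) ≡ f fzero + sum (map (f ∘ fsuc) (allFin n))
sum-allFin-suc {n} f =
  cong (λ xs → f fzero + sum xs) (trans (map-tabulate fsuc f) (sym (map-tabulate (λ i → i) (f ∘ fsuc))))

sum-allFin-toℕ : ∀ n (g : ℕ → ℕ) → sum (map (g ∘ toℕ) (allFin n)) ≡ sumUpTo g n
sum-allFin-toℕ zero    g = refl
sum-allFin-toℕ (suc n) g = trans (sum-allFin-suc {n} (g ∘ toℕ)) (cong (g 0 +_) (sum-allFin-toℕ n (g ∘ suc)))

injective⇒≤count : ∀ {k n} (P : Fin n → Bool) (g : Fin k → Fin n) → Injective _≡_ _≡_ g →
                   (∀ j → P (g j) ≡ true) → k ≤ sum (map (ind ∘ P) (allFin n))

injective-avoiding-zero⇒≤count : ∀ {k n} (P : Fin (suc n) → Bool) (g : Fin k → Fin (suc n)) →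
  Injective _≡_ _≡_ g → (∀ x → g x ≢ fzero) → (∀ x → P (g x) ≡ true) →
  k ≤ sum (map (ind ∘ P ∘ fsuc) (allFin n))
injective-avoiding-zero⇒≤count P g g-inj g≢0 Pg =
  injective⇒≤count (P ∘ fsuc) (λ x → punchOut (g≢0 x ∘ sym))
    (λ {x} {y} e → g-inj (punchOut-injective (g≢0 x ∘ sym) (g≢0 y ∘ sym) e))
    (λ x → subst (λ v → P v ≡ true) (sym (punchIn-punchOut (g≢0 x ∘ sym))) (Pg x))

injective⇒≤count {zero}  P g _ _ = z≤n
injective⇒≤count {suc k} {zero}  P g _ _ with g fzero
... | ()
injective⇒≤count {suc k} {suc n} P g g-inj Pg
  rewrite sum-allFin-suc (ind ∘ P) with any? (λ j → g j ≟ᶠ fzero)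
... | yes (j₀ , gj₀≡0) = begin
  suc k
    ≤⟨ s≤s (injective-avoiding-zero⇒≤count P (g ∘ punchIn j₀)
             (λ e → punchIn-injective j₀ _ _ (g-inj e))
             (λ x e → punchInᵢ≢i j₀ x (g-inj (trans e (sym gj₀≡0))))
             (Pg ∘ punchIn j₀)) ⟩
  1 + sum (map (ind ∘ P ∘ fsuc) (allFin n))
    ≡⟨ cong (λ b → ind b + sum (map (ind ∘ P ∘ fsuc) (allFin n)))
            (sym (subst (λ v → P v ≡ true) gj₀≡0 (Pg j₀))) ⟩
  ind (P fzero) + sum (map (ind ∘ P ∘ fsuc) (allFin n)) ∎
  where open ≤-Reasoning
... | no g≢0 = ≤-trans (injective-avoiding-zero⇒≤count P g g-inj (λ x e → g≢0 (x , e)) Pg) (m≤n+m _ _)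

injective-below⇒≤ : ∀ {m n a} (f : Fin m → Fin n) → Injective _≡_ _≡_ f →
                    (∀ x → toℕ (f x) < a) → m ≤ a
injective-below⇒≤ f f-inj f<a = injective⇒≤ {f = λ x → fromℕ< (f<a x)} λ {x} {y} e →
  f-inj (toℕ-injective (trans (sym (toℕ-fromℕ< (f<a x))) (trans (cong toℕ e) (toℕ-fromℕ< (f<a y)))))

-- Graphs

removeZero : ∀ {n} → Graph (suc n) → Graph n
removeZero G = record
  { adj    = λ i j → adj G (fsuc i) (fsuc j)
  ; sym    = λ i j → Graph.sym G (fsuc i) (fsuc j)
  ; irrefl = irrefl G ∘ fsuc
  }

σ-deg-removeZero : ∀ {n} (G : Graph (suc n)) →
                   σseq (deg G) ≡ 2 * deg G fzero + σseq (deg (removeZero G))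
σ-deg-removeZero {n} G = begin
  σseq (deg G)
    ≡⟨ sum-allFin-suc (deg G) ⟩
  deg G fzero + sum (map (deg G ∘ fsuc) (allFin n))
    ≡⟨ cong (deg G fzero +_) (trans (cong sum (map-cong (sum-allFin-suc ∘ row) (allFin n)))
                                    (sum-map-+ column (deg (removeZero G)) (allFin n))) ⟩
  deg G fzero + (sum (map column (allFin n)) + σseq (deg (removeZero G)))
    ≡⟨ cong (λ d → deg G fzero + (d + σseq (deg (removeZero G)))) column-sum ⟩
  deg G fzero + (deg G fzero + σseq (deg (removeZero G)))
    ≡⟨ +-assoc (deg G fzero) _ _ ⟨
  deg G fzero + deg G fzero + σseq (deg (removeZero G))
    ≡⟨ cong (λ t → deg G fzero + t + σseq (deg (removeZero G))) (+-identityʳ (deg G fzero)) ⟨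
  2 * deg G fzero + σseq (deg (removeZero G)) ∎
  where
  open ≡-Reasoning
  row : Fin n → Fin (suc n) → ℕ
  row i j = ind (adj G (fsuc i) j)
  column : Fin n → ℕ
  column i = ind (adj G (fsuc i) fzero)
  column-sum : sum (map column (allFin n)) ≡ deg G fzero
  column-sum = begin
    sum (map column (allFin n))
      ≡⟨ cong sum (map-cong (λ i → cong ind (Graph.sym G (fsuc i) fzero)) (allFin n)) ⟩
    sum (map (λ i → ind (adj G fzero (fsuc i))) (allFin n))
      ≡⟨ cong (λ b → ind b + sum (map (λ i → ind (adj G fzero (fsuc i))) (allFin n)))
              (sym (irrefl G fzero)) ⟩
    ind (adj G fzero fzero) + sum (map (λ i → ind (adj G fzero (fsuc i))) (allFin n))
      ≡⟨ sym (sum-allFin-suc (ind ∘ adj G fzero)) ⟩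
    deg G fzero ∎

handshake : ∀ {n} (G : Graph n) → 2 ∣ σseq (deg G)
handshake {zero}  G = 2 ∣0
handshake {suc n} G = subst (2 ∣_) (sym (σ-deg-removeZero G))
  (∣m∣n⇒∣m+n (m∣m*n (deg G fzero)) (handshake (removeZero G)))

module _ {r} {R : ℕ → ℕ → Set r} (R? : ∀ x y → Dec (R x y))
         (R-sym : ∀ {x y} → R x y → R y x) (R-irrefl : ∀ {x} → ¬ R x x) where

  relGraph : ∀ n → Graph n
  relGraph n = record
    { adj    = λ i j → does (R? (toℕ i) (toℕ j))
    ; sym    = λ i j → does-⇔ (mk⇔ R-sym R-sym) (R? _ _) (R? _ _)
    ; irrefl = λ i → dec-false (R? _ _) R-irrefl
    }

  deg-relGraph : ∀ {n} (i : Fin n) → deg (relGraph n) i ≡ count (R? (toℕ i)) n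
  deg-relGraph {n} i = sum-allFin-toℕ n (𝟙 ∘ R? (toℕ i))

module _ {l m n} {F : Graph l} {H : Graph m} {G : Graph n} where

  SubgraphOf-trans : SubgraphOf F H → SubgraphOf H G → SubgraphOf F G
  SubgraphOf-trans (f , f-inj , f-hom) (g , g-inj , g-hom) =
    g ∘ f , (λ e → f-inj (g-inj e)) , λ i j e → g-hom (f i) (f j) (f-hom i j e)

universal⇒≤deg : ∀ {k n} {H : Graph (suc k)} {G : Graph n} (emb : SubgraphOf H G) v →
                 (∀ u → v ≢ u → adj H v u ≡ true) → k ≤ deg G (proj₁ emb v)
universal⇒≤deg {G = G} (f , f-inj , f-hom) v v-universal =
  injective⇒≤count (adj G (f v)) (f ∘ punchIn v) (λ e → punchIn-injective v _ _ (f-inj e))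
    (λ j → f-hom v (punchIn v j) (v-universal (punchIn v j) (punchInᵢ≢i v j ∘ sym)))

K-K4-universal : ∀ {m} (v : Fin m) → 4 ≤ toℕ v → ∀ u → v ≢ u → adj (K-K4 m) v u ≡ true
K-K4-universal v 4≤v u v≢u = cong₂ (λ p q → not p ∧ not (q ∧ (toℕ u <ᵇ 4)))
  (dec-false (toℕ v ≟ toℕ u) (v≢u ∘ toℕ-injective)) (dec-false (toℕ v <? 4) (≤⇒≯ 4≤v))

K-K4⊆K-Z4 : ∀ m → SubgraphOf (K-K4 m) (K-Z4 m)
K-K4⊆K-Z4 m = (λ i → i) , (λ e → e) , λ i j → ∧-weaken (not (toℕ i ≡ᵇ toℕ j)) _ _
  where
  ∧-weaken : ∀ a b c → a ∧ b ≡ true → a ∧ (b ∨ c) ≡ true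
  ∧-weaken true true c _ = refl

module _ {m m′} {H : Graph m} {H′ : Graph m′} where

  PotentiallyGraphic-mono : SubgraphOf H H′ → ∀ {n} {π : Seq n} →
                            PotentiallyGraphic H′ π → PotentiallyGraphic H π
  PotentiallyGraphic-mono H⊆H′ (G , realizes , H′⊆G) =
    G , realizes , SubgraphOf-trans {F = H} {H = H′} {G = G} H⊆H′ H′⊆G

  IsSigma-mono : SubgraphOf H H′ → ∀ {n s s′} → IsSigma H n s → IsSigma H′ n s′ → s ≤ s′
  IsSigma-mono H⊆H′ (_ , minimal) ((s′-even , s′-admissible) , _) =
    minimal _ (s′-even , λ π graphic big → PotentiallyGraphic-mono H⊆H′ (s′-admissible π graphic big))

even<even⇒+2≤ : ∀ {a b} → 2 ∣ a → 2 ∣ b → a < b → a + 2 ≤ b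
even<even⇒+2≤ {b = b} (divides p refl) (divides q refl) p*2<q*2 = begin
  p * 2 + 2  ≡⟨ +-comm (p * 2) 2 ⟩
  suc p * 2  ≤⟨ *-monoˡ-≤ 2 (*-cancelʳ-< 2 p q p*2<q*2) ⟩
  q * 2      ∎
  where open ≤-Reasoning

σ-graphic-even : ∀ {n} {π : Seq n} → Graphic π → 2 ∣ σseq π
σ-graphic-even {n} (_ , G , realizes) =
  subst (2 ∣_) (cong sum (map-cong realizes (allFin n))) (handshake G)

σ+2≤IsSigma : ∀ {m n} {H : Graph m} {π : Seq n} {s} → Graphic π → ¬ PotentiallyGraphic H π →
              IsSigma H n s → σseq π + 2 ≤ s
σ+2≤IsSigma graphic not-potentially ((s-even , s-admissible) , _) =
  even<even⇒+2≤ (σ-graphic-even graphic) s-even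
    (≰⇒> λ s≤σ → not-potentially (s-admissible _ graphic s≤σ))

-- The extremal sequence

record Shift {c} (d : ℕ) (C : Pred ℕ c) (x y : ℕ) : Set c where
  constructor shift
  field
    source : C x
    target : y ≡ x + d

module _ {c} {C : Pred ℕ c} (C? : Decidable C) (d : ℕ) where

  shift? : ∀ x y → Dec (Shift d C x y)
  shift? x y = map′ (λ (Cx , y≡x+d) → shift Cx y≡x+d) (λ (shift Cx y≡x+d) → Cx , y≡x+d)
                    (C? x ×-dec (y ≟ x + d))

  count-shift-out : ∀ {x n} → (C x → x + d < n) → count (shift? x) n ≡ 𝟙 (C? x)
  count-shift-out = count-point (C? _)

  count-shift-in : ∀ {x n} → x < n → count (λ y → shift? y x) n ≡ 𝟙 (d ≤? x ×-dec C? (x ∸ d))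
  count-shift-in {x} {n} x<n = trans
    (count-cong (λ y → shift? y x) (λ y → (d ≤? x ×-dec C? (x ∸ d)) ×-dec (y ≟ x ∸ d)) n
                (λ _ → mk⇔ to from))
    (count-point (d ≤? x ×-dec C? (x ∸ d)) (λ _ → ≤-<-trans (m∸n≤m x d) x<n))
    where
    to : ∀ {y} → Shift d C y x → (d ≤ x × C (x ∸ d)) × y ≡ x ∸ d
    to {y} (shift Cy refl) = (m≤n+m d y , subst C (sym (m+n∸n≡m y d)) Cy) , sym (m+n∸n≡m y d)
    from : ∀ {y} → (d ≤ x × C (x ∸ d)) × y ≡ x ∸ d → Shift d C y x
    from ((d≤x , Cx∸d) , refl) = shift Cx∸d (sym (m∸n+n≡m d≤x))

Shift-injective : ∀ {c c′} {C : Pred ℕ c} {C′ : Pred ℕ c′} {d d′ x y} →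
                  Shift d C x y → Shift d′ C′ x y → d ≡ d′
Shift-injective {x = x} (shift _ refl) (shift _ eq) = +-cancelˡ-≡ x _ _ eq

Shift-< : ∀ {c} {C : Pred ℕ c} {d x y} → 0 < d → Shift d C x y → x < y
Shift-< {x = x} 0<d (shift _ refl) = m<m+n x 0<d

+-shuffle : ∀ a b c d e f → (a + (b + c)) + (d + (e + f)) ≡ (a + e) + (b + d) + (c + f)
+-shuffle = solve-∀

-- The cycle 0 - 1 - ⋯ - M - 0 with the chords x - (x + h), x < h.  Each edge is stored once, as an
-- arc x → x + d with d > 0, so that symmetry is free and the degree of x splits into the arcs
-- leaving x and the arcs entering x.
module ChordedCycle (M h : ℕ) (1<h : 1 < h) (h<M : h < M) (h+h≤1+M : h + h ≤ suc M) where

  Arc : ℕ → ℕ → Set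
  Arc x y = Shift 1 (_< M) x y ⊎ Shift M (_≡ 0) x y ⊎ Shift h (_< h) x y

  path? : ∀ x y → Dec (Shift 1 (_< M) x y)
  path? = shift? (_<? M) 1

  close? : ∀ x y → Dec (Shift M (_≡ 0) x y)
  close? = shift? (_≟ 0) M

  chord? : ∀ x y → Dec (Shift h (_< h) x y)
  chord? = shift? (_<? h) h

  arc? : ∀ x y → Dec (Arc x y)
  arc? x y = path? x y ⊎-dec close? x y ⊎-dec chord? x y

  Edge : ℕ → ℕ → Set
  Edge x y = Arc x y ⊎ Arc y x

  edge? : ∀ x y → Dec (Edge x y)
  edge? x y = arc? x y ⊎-dec arc? y x

  Edge-sym : ∀ {x y} → Edge x y → Edge y x
  Edge-sym (inj₁ xy) = inj₂ xy
  Edge-sym (inj₂ yx) = inj₁ yx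

  0<h : 0 < h
  0<h = <-trans z<s 1<h

  Arc-< : ∀ {x y} → Arc x y → x < y
  Arc-< (inj₁ path)          = Shift-< z<s path
  Arc-< (inj₂ (inj₁ close))  = Shift-< (<-trans 0<h h<M) close
  Arc-< (inj₂ (inj₂ chord))  = Shift-< 0<h chord

  Edge-irrefl : ∀ {x} → ¬ Edge x x
  Edge-irrefl (inj₁ xx) = <-irrefl refl (Arc-< xx)
  Edge-irrefl (inj₂ xx) = <-irrefl refl (Arc-< xx)

  count-arcs : ∀ n (u v : ℕ → ℕ) →
    count (λ y → arc? (u y) (v y)) n ≡
    count (λ y → path? (u y) (v y)) n +
      (count (λ y → close? (u y) (v y)) n + count (λ y → chord? (u y) (v y)) n)
  count-arcs n u v = trans
    (count-⊎ (λ y → path? (u y) (v y)) (λ y → close? (u y) (v y) ⊎-dec chord? (u y) (v y)) n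
       (λ s → [ distinct (<⇒≢ (<-trans 1<h h<M)) s , distinct (<⇒≢ 1<h) s ]))
    (cong (count (λ y → path? (u y) (v y)) n +_)
      (count-⊎ (λ y → close? (u y) (v y)) (λ y → chord? (u y) (v y)) n (distinct (<⇒≢ h<M ∘ sym))))
    where
    distinct : ∀ {c c′} {C : Pred ℕ c} {C′ : Pred ℕ c′} {d d′ x y} →
               d ≢ d′ → Shift d C x y → ¬ Shift d′ C′ x y
    distinct d≢d′ s s′ = d≢d′ (Shift-injective s s′)

  count-arcs-out : ∀ {x} → count (arc? x) (suc M) ≡ 𝟙 (x <? M) + (𝟙 (x ≟ 0) + 𝟙 (x <? h))
  count-arcs-out {x} = trans (count-arcs (suc M) (λ _ → x) (λ y → y)) (cong₂ _+_
    (count-shift-out (_<? M) 1 {x} {suc M} (λ x<M → subst (_< suc M) (+-comm 1 x) (s≤s x<M)))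
    (cong₂ _+_ (count-shift-out (_≟ 0) M {x} {suc M} (λ { refl → n<1+n M }))
               (count-shift-out (_<? h) h {x} {suc M} (λ x<h → <-≤-trans (+-monoˡ-< h x<h) h+h≤1+M))))

  count-arcs-in : ∀ {x} → x < suc M → count (λ y → arc? y x) (suc M) ≡
    𝟙 (1 ≤? x ×-dec (x ∸ 1 <? M)) + (𝟙 (M ≤? x ×-dec (x ∸ M ≟ 0)) + 𝟙 (h ≤? x ×-dec (x ∸ h <? h)))
  count-arcs-in {x} x<1+M = trans (count-arcs (suc M) (λ y → y) (λ _ → x)) (cong₂ _+_
    (count-shift-in (_<? M) 1 x<1+M)
    (cong₂ _+_ (count-shift-in (_≟ 0) M x<1+M) (count-shift-in (_<? h) h x<1+M)))

  path-end : ∀ {x} → x < suc M → 𝟙 (x <? M) + 𝟙 (M ≤? x ×-dec (x ∸ M ≟ 0)) ≡ 1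
  path-end {x} x<1+M =
    𝟙-exactly-one (x <? M) (M ≤? x ×-dec (x ∸ M ≟ 0)) (λ x<M (M≤x , _) → <⇒≱ x<M M≤x)
    ([ inj₁ , (λ { refl → inj₂ (≤-refl , n∸n≡0 M) }) ] (m≤n⇒m<n∨m≡n (≤-pred x<1+M)))

  path-start : ∀ {x} → x < suc M → 𝟙 (x ≟ 0) + 𝟙 (1 ≤? x ×-dec (x ∸ 1 <? M)) ≡ 1
  path-start {x} x<1+M =
    𝟙-exactly-one (x ≟ 0) (1 ≤? x ×-dec (x ∸ 1 <? M)) (λ { refl (() , _) }) (zero-or-pred x x<1+M)
    where
    zero-or-pred : ∀ x → x < suc M → x ≡ 0 ⊎ (1 ≤ x × x ∸ 1 < M)
    zero-or-pred zero    _         = inj₁ refl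
    zero-or-pred (suc x) (s≤s x<M) = inj₂ (s≤s z≤n , x<M)

  chord-ends : ∀ x → 𝟙 (x <? h) + 𝟙 (h ≤? x ×-dec (x ∸ h <? h)) ≡ 𝟙 (x <? h + h)
  chord-ends x = trans
    (sym (𝟙-⊎ (λ x<h (h≤x , _) → <⇒≱ x<h h≤x) (x <? h) (h ≤? x ×-dec (x ∸ h <? h))))
    (𝟙-⇔ (mk⇔ to from) (x <? h ⊎-dec (h ≤? x ×-dec (x ∸ h <? h))) (x <? h + h))
    where
    to : x < h ⊎ (h ≤ x × x ∸ h < h) → x < h + h
    to (inj₁ x<h)           = <-≤-trans x<h (m≤m+n h h)
    to (inj₂ (h≤x , x∸h<h)) = subst (_< h + h) (m∸n+n≡m h≤x) (+-monoˡ-< h x∸h<h)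
    from : x < h + h → x < h ⊎ (h ≤ x × x ∸ h < h)
    from x<2h with x <? h
    ... | yes x<h = inj₁ x<h
    ... | no  x≮h = inj₂ (h≤x , +-cancelʳ-< h (x ∸ h) h (subst (_< h + h) (sym (m∸n+n≡m h≤x)) x<2h))
      where h≤x = ≮⇒≥ x≮h

  count-edge : ∀ {x} → x < suc M → count (edge? x) (suc M) ≡ 2 + 𝟙 (x <? h + h)
  count-edge {x} x<1+M = begin
    count (edge? x) (suc M)
      ≡⟨ count-⊎ (arc? x) (λ y → arc? y x) (suc M) (λ xy yx → <-asym (Arc-< xy) (Arc-< yx)) ⟩
    count (arc? x) (suc M) + count (λ y → arc? y x) (suc M)
      ≡⟨ cong₂ _+_ count-arcs-out (count-arcs-in x<1+M) ⟩
    (𝟙 (x <? M) + (𝟙 (x ≟ 0) + 𝟙 (x <? h))) +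
    (𝟙 (1 ≤? x ×-dec (x ∸ 1 <? M)) + (𝟙 (M ≤? x ×-dec (x ∸ M ≟ 0)) + 𝟙 (h ≤? x ×-dec (x ∸ h <? h))))
      ≡⟨ +-shuffle (𝟙 (x <? M)) (𝟙 (x ≟ 0)) (𝟙 (x <? h)) (𝟙 (1 ≤? x ×-dec (x ∸ 1 <? M)))
                   (𝟙 (M ≤? x ×-dec (x ∸ M ≟ 0))) (𝟙 (h ≤? x ×-dec (x ∸ h <? h))) ⟩
    (𝟙 (x <? M) + 𝟙 (M ≤? x ×-dec (x ∸ M ≟ 0))) + (𝟙 (x ≟ 0) + 𝟙 (1 ≤? x ×-dec (x ∸ 1 <? M))) +
    (𝟙 (x <? h) + 𝟙 (h ≤? x ×-dec (x ∸ h <? h)))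
      ≡⟨ cong₂ _+_ (cong₂ _+_ (path-end x<1+M) (path-start x<1+M)) (chord-ends x) ⟩
    2 + 𝟙 (x <? h + h) ∎
    where open ≡-Reasoning

-- The join of the complete graph on 0, …, B - 1 with the graph R moved to B, B + 1, ….
module Join (B : ℕ) {R : ℕ → ℕ → Set} (R? : ∀ x y → Dec (R x y))
            (R-sym : ∀ {x y} → R x y → R y x) (R-irrefl : ∀ {x} → ¬ R x x) where

  Edge : ℕ → ℕ → Set
  Edge k l = k ≢ l × (k < B ⊎ l < B ⊎ R (k ∸ B) (l ∸ B))

  edge? : ∀ k l → Dec (Edge k l)
  edge? k l = ¬? (k ≟ l) ×-dec (k <? B ⊎-dec l <? B ⊎-dec R? (k ∸ B) (l ∸ B))

  Edge-sym : ∀ {k l} → Edge k l → Edge l k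
  Edge-sym (k≢l , inj₁ k<B)          = k≢l ∘ sym , inj₂ (inj₁ k<B)
  Edge-sym (k≢l , inj₂ (inj₁ l<B))   = k≢l ∘ sym , inj₁ l<B
  Edge-sym (k≢l , inj₂ (inj₂ R-k-l)) = k≢l ∘ sym , inj₂ (inj₂ (R-sym R-k-l))

  Edge-irrefl : ∀ {k} → ¬ Edge k k
  Edge-irrefl (k≢k , _) = k≢k refl

  count-edge-hub : ∀ {k N} → k < B → count (edge? k) (B + suc N) ≡ B + N
  count-edge-hub {k} {N} k<B = suc-injective (begin
    1 + count (edge? k) (B + suc N)
      ≡⟨ cong₂ _+_ (sym (count-≡ (<-≤-trans k<B (m≤m+n B (suc N)))))
                   (count-cong (edge? k) (¬? ∘ (_≟ k)) (B + suc N)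
                      (λ _ → mk⇔ (λ (k≢l , _) → k≢l ∘ sym) (λ l≢k → l≢k ∘ sym , inj₁ k<B))) ⟩
    count (_≟ k) (B + suc N) + count (¬? ∘ (_≟ k)) (B + suc N)
      ≡⟨ count-∁ (_≟ k) (B + suc N) ⟩
    B + suc N
      ≡⟨ +-suc B N ⟩
    suc (B + N) ∎)
    where open ≡-Reasoning

  count-edge-rim : ∀ x N → count (edge? (B + x)) (B + N) ≡ B + count (R? x) N
  count-edge-rim x N = trans (sumUpTo-+-range (𝟙 ∘ edge? (B + x)) B N) (cong₂ _+_
    (count-all (edge? (B + x)) B
      (λ l<B → (λ B+x≡l → <⇒≱ l<B (subst (B ≤_) B+x≡l (m≤m+n B x))) , inj₂ (inj₁ l<B)))
    (count-cong (edge? (B + x) ∘ (B +_)) (R? x) N λ _ → mk⇔ to from))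
    where
    to : ∀ {y} → Edge (B + x) (B + y) → R x y
    to (_ , inj₁ B+x<B)          = ⊥-elim (m+n≮m B x B+x<B)
    to (_ , inj₂ (inj₁ B+y<B))   = ⊥-elim (m+n≮m B _ B+y<B)
    to {y} (_ , inj₂ (inj₂ R-xy)) = subst₂ R (m+n∸m≡n B x) (m+n∸m≡n B y) R-xy
    from : ∀ {y} → R x y → Edge (B + x) (B + y)
    from {y} R-xy = (λ e → R-irrefl (subst (R x) (sym (+-cancelˡ-≡ B x y e)) R-xy))
                  , inj₂ (inj₂ (subst₂ R (sym (m+n∸m≡n B x)) (sym (m+n∸m≡n B y)) R-xy))

module Extremal (B M h : ℕ) (1<h : 1 < h) (h<M : h < M) (h+h≤1+M : h + h ≤ suc M) where

  open ChordedCycle M h 1<h h<M h+h≤1+M using (edge?; Edge-sym; Edge-irrefl; count-edge)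
  module J = Join B edge? Edge-sym Edge-irrefl

  n : ℕ
  n = B + suc M

  G : Graph n
  G = relGraph J.edge? J.Edge-sym J.Edge-irrefl n

  degree : ℕ → ℕ
  degree k = count (J.edge? k) n

  degree-hub : ∀ {k} → k < B → degree k ≡ B + M
  degree-hub = J.count-edge-hub

  degree-rim : ∀ {x} → x < suc M → degree (B + x) ≡ B + (2 + 𝟙 (x <? h + h))
  degree-rim {x} x<1+M = trans (J.count-edge-rim x (suc M)) (cong (B +_) (count-edge x<1+M))

  degree-rim-≤ : ∀ {x} → x < suc M → degree (B + x) ≤ B + 3
  degree-rim-≤ {x} x<1+M =
    ≤-trans (≤-reflexive (degree-rim x<1+M)) (+-monoʳ-≤ B (+-monoʳ-≤ 2 (𝟙≤1 (x <? h + h))))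

  degree-antitone : ∀ {k l} → k ≤ l → l < n → degree l ≤ degree k
  degree-antitone {k} {l} k≤l l<n with l <? B | k <? B
  ... | yes l<B | yes k<B = ≤-reflexive (trans (degree-hub l<B) (sym (degree-hub k<B)))
  ... | yes l<B | no  k≮B = ⊥-elim (k≮B (≤-<-trans k≤l l<B))
  ... | no  l≮B | yes k<B with m≤n⇒∃[o]m+o≡n (≮⇒≥ l≮B)
  ...   | y , refl = begin
    degree (B + y)  ≤⟨ degree-rim-≤ (+-cancelˡ-< B y (suc M) l<n) ⟩
    B + 3           ≤⟨ +-monoʳ-≤ B (≤-trans (s≤s 1<h) h<M) ⟩
    B + M           ≡⟨ degree-hub k<B ⟨
    degree k        ∎
    where open ≤-Reasoning
  degree-antitone {k} {l} k≤l l<n | no l≮B | no k≮B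
    with m≤n⇒∃[o]m+o≡n (≮⇒≥ k≮B) | m≤n⇒∃[o]m+o≡n (≮⇒≥ l≮B)
  ...   | x , refl | y , refl = begin
    degree (B + y)                 ≡⟨ degree-rim y<1+M ⟩
    B + (2 + 𝟙 (y <? h + h))
      ≤⟨ +-monoʳ-≤ B (+-monoʳ-≤ 2 (𝟙-mono (y <? h + h) (x <? h + h) (≤-<-trans x≤y))) ⟩
    B + (2 + 𝟙 (x <? h + h))        ≡⟨ degree-rim (≤-<-trans x≤y y<1+M) ⟨
    degree (B + x)                 ∎
    where
    open ≤-Reasoning
    x≤y = +-cancelˡ-≤ B x y k≤l
    y<1+M = +-cancelˡ-< B y (suc M) l<n

  hub-of-degree : ∀ {k} → k < n → 4 + B ≤ degree k → k < B
  hub-of-degree {k} k<n 4+B≤degree with k <? B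
  ... | yes k<B = k<B
  ... | no  k≮B with m≤n⇒∃[o]m+o≡n (≮⇒≥ k≮B)
  ...   | x , refl = ⊥-elim (<-irrefl refl (≤-trans 4+B≤degree
                       (≤-trans (degree-rim-≤ (+-cancelˡ-< B x (suc M) k<n)) (≤-reflexive (+-comm B 3)))))

  σ-degree : sumUpTo degree n ≡ B * (B + M) + (suc M * (B + 2) + (h + h))
  σ-degree = begin
    sumUpTo degree (B + suc M)
      ≡⟨ sumUpTo-+-range degree B (suc M) ⟩
    sumUpTo degree B + sumUpTo (degree ∘ (B +_)) (suc M)
      ≡⟨ cong₂ _+_ (sumUpTo-cong B degree-hub)
                   (sumUpTo-cong (suc M) (λ x<1+M → trans (degree-rim x<1+M) (sym (+-assoc B 2 _)))) ⟩
    sumUpTo (λ _ → B + M) B + sumUpTo (λ x → B + 2 + 𝟙 (x <? h + h)) (suc M)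
      ≡⟨ cong₂ _+_ (sumUpTo-const (B + M) B)
                   (trans (sumUpTo-+ (λ _ → B + 2) (λ x → 𝟙 (x <? h + h)) (suc M))
                          (cong₂ _+_ (sumUpTo-const (B + 2) (suc M)) (count-< h+h≤1+M))) ⟩
    B * (B + M) + (suc M * (B + 2) + (h + h)) ∎
    where open ≡-Reasoning

  π : Seq n
  π = deg G

  π≡degree : ∀ i → π i ≡ degree (toℕ i)
  π≡degree = deg-relGraph J.edge? J.Edge-sym J.Edge-irrefl

  graphic : Graphic π
  graphic = nonIncreasing , G , λ _ → refl
    where
    nonIncreasing : NonIncreasing π
    nonIncreasing i j i≤j =
      subst₂ _≤_ (sym (π≡degree j)) (sym (π≡degree i)) (degree-antitone i≤j (toℕ<n j))

  σ-π : σseq π ≡ B * (B + M) + (suc M * (B + 2) + (h + h))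
  σ-π = trans (cong sum (map-cong π≡degree (allFin n))) (trans (sum-allFin-toℕ n degree) σ-degree)

  not-potentially : ¬ PotentiallyGraphic (K-K4 (5 + B)) π
  not-potentially (G′ , realizes , embedding@(f , f-inj , _)) =
    <-irrefl refl (injective-below⇒≤ (f ∘ hub) (λ e → ↑ʳ-injective 4 _ _ (f-inj e)) hubs-below-B)
    where
    hub : Fin (suc B) → Fin (5 + B)
    hub x = 4 ↑ʳ x
    hubs-below-B : ∀ x → toℕ (f (hub x)) < B
    hubs-below-B x = hub-of-degree (toℕ<n (f (hub x))) (begin
      4 + B                     ≤⟨ universal⇒≤deg {H = K-K4 (5 + B)} {G = G′} embedding (hub x)
                                     (K-K4-universal (hub x) (m≤m+n 4 (toℕ x))) ⟩
      deg G′ (f (hub x))        ≡⟨ realizes (f (hub x)) ⟩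
      π (f (hub x))             ≡⟨ π≡degree (f (hub x)) ⟩
      degree (toℕ (f (hub x)))  ∎)
      where open ≤-Reasoning

-- σ(π) for Extremal B M h with M = 3 + d and h = 2 + ⌊d/2⌋, so that 2h = M + 1 - (d mod 2):
-- as many vertices of degree B + 3 as parity allows.
extremalσ : ℕ → ℕ → ℕ
extremalσ B d = B * (B + (3 + d)) + (suc (3 + d) * (B + 2) + ((2 + d / 2) + (2 + d / 2)))

extremalσ+2≤σ : ∀ B d {s} → IsSigma (K-K4 (5 + B)) (4 + B + d) s → extremalσ B d + 2 ≤ s
extremalσ+2≤σ B d {s} σ-spec =
  subst (λ t → t + 2 ≤ s) σ-π (σ+2≤IsSigma {H = K-K4 (5 + B)} {π = π} graphic not-potentially
    (subst (λ n → IsSigma (K-K4 (5 + B)) n s) vertex-count σ-spec))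
  where
  chords-fit : (2 + d / 2) + (2 + d / 2) ≤ 4 + d
  chords-fit = begin
    (2 + d / 2) + (2 + d / 2)  ≡⟨ double (d / 2) ⟩
    4 + d / 2 * 2              ≤⟨ +-monoʳ-≤ 4 (m≤n+m (d / 2 * 2) (d % 2)) ⟩
    4 + (d % 2 + d / 2 * 2)    ≡⟨ cong (4 +_) (m≡m%n+[m/n]*n d 2) ⟨
    4 + d                      ∎
    where
    open ≤-Reasoning
    double : ∀ q → (2 + q) + (2 + q) ≡ 4 + q * 2
    double = solve-∀
  open Extremal B (3 + d) (2 + d / 2) (s≤s (s≤s z≤n)) (+-monoʳ-≤ 3 (m/n≤m d 2)) chords-fit
  vertex-count : 4 + B + d ≡ B + (4 + d)
  vertex-count = trans (cong (_+ d) (+-comm 4 B)) (+-assoc B 4 d)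

bound≡extremalσ+parity : ∀ B d → let r = 4 + B; n = r + d in
  (r ∸ 1) * (2 * n ∸ r) ∸ 3 * (n ∸ r) ≡ extremalσ B d + (n ∸ r) % 2
bound≡extremalσ+parity B d = begin
  (3 + B) * (2 * (r + d) ∸ r) ∸ 3 * (r + d ∸ r)
    ≡⟨ cong₂ (λ a b → (3 + B) * a ∸ 3 * b)
             (trans (cong (_∸ r) (double r d)) (m+n∸m≡n r (r + 2 * d))) (m+n∸m≡n r d) ⟩
  (3 + B) * (r + 2 * d) ∸ 3 * d
    ≡⟨ cong (_∸ 3 * d) expand ⟩
  extremalσ B d + d % 2 + 3 * d ∸ 3 * d
    ≡⟨ m+n∸n≡m (extremalσ B d + d % 2) (3 * d) ⟩
  extremalσ B d + d % 2
    ≡⟨ cong (λ t → extremalσ B d + t % 2) (m+n∸m≡n r d) ⟨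
  extremalσ B d + (r + d ∸ r) % 2 ∎
  where
  open ≡-Reasoning
  r = 4 + B
  double : ∀ r d → 2 * (r + d) ≡ r + (r + 2 * d)
  double = solve-∀
  identity : ∀ B e q → let d = e + q * 2 in
    (3 + B) * (4 + B + 2 * d) ≡ B * (B + (3 + d)) + (suc (3 + d) * (B + 2) + ((2 + q) + (2 + q))) + e + 3 * d
  identity = solve-∀
  expand : (3 + B) * (r + 2 * d) ≡ extremalσ B d + d % 2 + 3 * d
  expand = subst (λ t → (3 + B) * (r + 2 * t) ≡
                        B * (B + (3 + t)) + (suc (3 + t) * (B + 2) + ((2 + d / 2) + (2 + d / 2))) + d % 2 + 3 * t)
                 (sym (m≡m%n+[m/n]*n d 2)) (identity B (d % 2) (d / 2))

lemma3p6 : ∀ (r n : ℕ) → r ≥ 4 → n ≥ suc r →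
    ∀ (sZ sK : ℕ) → IsSigma (K-Z4 (suc r)) n sZ → IsSigma (K-K4 (suc r)) n sK →
    sZ ≥ sK ×
    ((n ∸ r) % 2 ≡ 1 → sK ≥ (r ∸ 1) * (2 * n ∸ r) ∸ 3 * (n ∸ r) + 1) ×
    ((n ∸ r) % 2 ≡ 0 → sK ≥ (r ∸ 1) * (2 * n ∸ r) ∸ 3 * (n ∸ r) + 2)
lemma3p6 r n r≥4 r<n sZ sK σZ σK with m≤n⇒∃[o]m+o≡n r≥4 | m≤n⇒∃[o]m+o≡n (<⇒≤ r<n)
... | B , refl | d , refl =
  IsSigma-mono {H = K-K4 (5 + B)} {H′ = K-Z4 (5 + B)} (K-K4⊆K-Z4 (5 + B)) σK σZ , odd , even
  where
  σ+2≤sK = extremalσ+2≤σ B d σK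
  odd : (4 + B + d ∸ (4 + B)) % 2 ≡ 1 → _
  odd d-odd = ≤-trans (≤-reflexive (begin
    _                       ≡⟨ cong (_+ 1) (bound≡extremalσ+parity B d) ⟩
    extremalσ B d + _ + 1   ≡⟨ cong (λ p → extremalσ B d + p + 1) d-odd ⟩
    extremalσ B d + 1 + 1   ≡⟨ +-assoc (extremalσ B d) 1 1 ⟩
    extremalσ B d + 2       ∎)) σ+2≤sK
    where open ≡-Reasoning
  even : (4 + B + d ∸ (4 + B)) % 2 ≡ 0 → _
  even d-even = ≤-trans (≤-reflexive (begin
    _                       ≡⟨ cong (_+ 2) (bound≡extremalσ+parity B d) ⟩
    extremalσ B d + _ + 2   ≡⟨ cong (λ p → extremalσ B d + p + 2) d-even ⟩
    extremalσ B d + 0 + 2   ≡⟨ cong (_+ 2) (+-identityʳ (extremalσ B d)) ⟩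
    extremalσ B d + 2       ∎)) σ+2≤sK
    where open ≡-Reasoning
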